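{- Let $w\in\mathcal{A}^*$ be a $c$-epichristoffel word. Then the set of all factors of length at most $|w|$ of the words conjugate to $w$ is closed under reversal (mirror image).
   Context: $\mathcal{A}$ is a finite alphabet. Words $w,w'$ are conjugate if $w=xy$, $w'=yx$ for some words $x,y$. The reversal of $w[0]\cdots w[n-1]$ is $w[n-1]\cdots w[0]$. For $a,b\in\mathcal{A}$: $\psi_a(a)=\overline{\psi}_a(a)=a$, $\psi_a(x)=ax$, $\overline{\psi}_a(x)=xa$ for letters $x\neq a$, and $\theta_{ab}$ swaps $a,b$ and fixes other letters. Episturmian morphisms are the compositions of these morphisms. A finite word is $c$-epichristoffel if it is the image of a letter under an episturmian morphism. -}

module Defs where

open import Data.Nat using (ℕ; _≤_)
open import Data.Fin using (Fin; _≟_)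
open import Data.List using (List; []; _∷_; _++_; concatMap; reverse; length)
open import Data.Product using (∃; ∃-syntax; _×_)
open import Relation.Binary.PropositionalEquality using (_≡_)
open import Relation.Nullary using (yes; no)

Word : ℕ → Set
Word k = List (Fin k)

Subst : ℕ → Set
Subst k = Fin k → Word k

apply : ∀ {k} → Subst k → Word k → Word k
apply f w = concatMap f w

ψ : ∀ {k} → Fin k → Subst k
ψ a x with x ≟ a
... | yes _ = a ∷ []
... | no  _ = a ∷ x ∷ []

ψbar : ∀ {k} → Fin k → Subst k
ψbar a x with x ≟ a
... | yes _ = a ∷ []
... | no  _ = x ∷ a ∷ []

θ : ∀ {k} → Fin k → Fin k → Subst k
θ a b x with x ≟ a
... | yes _ = b ∷ []
... | no  _ with x ≟ b
...   | yes _ = a ∷ []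
...   | no  _ = x ∷ []

-- Episturmian morphisms: finite compositions of the elementary morphisms
-- (the empty composition is the identity).  Represented syntactically.
data Generator (k : ℕ) : Set where
  gψ    : Fin k → Generator k
  gψbar : Fin k → Generator k
  gθ    : Fin k → Fin k → Generator k

⟦_⟧g : ∀ {k} → Generator k → Subst k
⟦ gψ a ⟧g    = ψ a
⟦ gψbar a ⟧g = ψbar a
⟦ gθ a b ⟧g  = θ a b

applyEpi : ∀ {k} → List (Generator k) → Word k → Word k
applyEpi []       w = w
applyEpi (g ∷ gs) w = apply ⟦ g ⟧g (applyEpi gs w)

IsCEpichristoffel : ∀ {k} → Word k → Set
IsCEpichristoffel {k} w = ∃[ gs ] ∃[ a ] (w ≡ applyEpi gs (a ∷ []))

Conjugate : ∀ {k} → Word k → Word k → Set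
Conjugate {k} w w' = ∃[ x ] ∃[ y ] (w ≡ x ++ y × w' ≡ y ++ x)

Factor : ∀ {k} → Word k → Word k → Set
Factor {k} u v = ∃[ p ] ∃[ s ] (v ≡ p ++ u ++ s)

InConjFactors : ∀ {k} → Word k → Word k → Set
InConjFactors {k} w u = length u ≤ length w × ∃[ v ] (Conjugate w v × Factor u v)

-- The key fact is that such a w is conjugate to its own reversal w̃.  Then
-- every conjugate v = yx of w = xy has reversal x̃ỹ, a conjugate of w̃ and
-- hence of w, and any factor u of v has ũ as a factor of ṽ; so ũ lies in
-- the set together with u.
--
-- We
-- use that conjugacy is an equivalence relation (transitivity rests on
-- Levi's lemma for equations xy = x'y'), that it is preserved by
-- morphisms and by reversal, and that each elementary morphism g has a
-- "mirror" g* with (g w)~ = g*(w̃) and g w conjugate to g* w: the mirror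
-- of ψ_a is ψ̄_a (and ψ_a(w)·a = a·ψ̄_a(w)), while θ_ab is its own mirror.
-- Then g w ~ g* w ~ g*(w̃) = (g w)~.
module Submission where

open import Defs
open import Data.Nat using (ℕ; _≤_)
open import Data.Fin using (Fin; _≟_)
open import Data.List using (List; []; _∷_; _++_; reverse)
open import Data.List.Properties
  using (∷-injective; ++-assoc; ++-identityʳ; reverse-++; unfold-reverse;
         length-reverse; concatMap-++; concatMap-cong)
open import Data.Product using (_,_; _×_; ∃-syntax)
open import Data.Sum using (_⊎_; inj₁; inj₂)
open import Function using (_∘_)
open import Relation.Nullary using (yes; no)
open import Relation.Binary.PropositionalEquality
  using (_≡_; _≗_; refl; sym; trans; cong; cong₂; subst; module ≡-Reasoning)

module _ {k : ℕ} where

  levi : (y x x' y' : Word k) → y ++ x ≡ x' ++ y' →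
         ∃[ m ] ((y ≡ x' ++ m × y' ≡ m ++ x) ⊎ (x' ≡ y ++ m × x ≡ m ++ y'))
  levi y x [] y' e = y , inj₁ (refl , sym e)
  levi [] x (c ∷ x') y' e = c ∷ x' , inj₂ (refl , e)
  levi (d ∷ y) x (c ∷ x') y' e with ∷-injective e
  ... | refl , e' with levi y x x' y' e'
  ...   | m , inj₁ (p , q) = m , inj₁ (cong (d ∷_) p , q)
  ...   | m , inj₂ (p , q) = m , inj₂ (cong (d ∷_) p , q)

  conj-refl : (w : Word k) → Conjugate w w
  conj-refl w = [] , w , refl , sym (++-identityʳ w)

  conj-sym : {w v : Word k} → Conjugate w v → Conjugate v w
  conj-sym (x , y , w≡xy , v≡yx) = y , x , v≡yx , w≡xy

  -- From w = xy, v = yx = x'y', t = y'x': Levi's lemma splits the middle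
  -- equation and exhibits t as a rotation of w.
  conj-trans : {w v t : Word k} → Conjugate w v → Conjugate v t → Conjugate w t
  conj-trans (x , y , w≡xy , v≡yx) (x' , y' , v≡x'y' , t≡y'x')
    with levi y x x' y' (trans (sym v≡yx) v≡x'y')
  ... | m , inj₁ (y≡x'm , y'≡mx) =
        x ++ x' , m ,
        trans w≡xy (trans (cong (x ++_) y≡x'm) (sym (++-assoc x x' m))) ,
        trans t≡y'x' (trans (cong (_++ x') y'≡mx) (++-assoc m x x'))
  ... | m , inj₂ (x'≡ym , x≡my') =
        m , y' ++ y ,
        trans w≡xy (trans (cong (_++ y) x≡my') (++-assoc m y' y)) ,
        trans t≡y'x' (trans (cong (y' ++_) x'≡ym) (sym (++-assoc y' y m)))

  conj-apply : (f : Subst k) {w v : Word k} →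
               Conjugate w v → Conjugate (apply f w) (apply f v)
  conj-apply f (x , y , refl , refl) =
    apply f x , apply f y , concatMap-++ f x y , concatMap-++ f y x

  conj-reverse : {w v : Word k} → Conjugate w v → Conjugate (reverse w) (reverse v)
  conj-reverse (x , y , refl , refl) =
    reverse y , reverse x , reverse-++ x y , reverse-++ y x

  conj-letter : (a : Fin k) (u v : Word k) → u ++ a ∷ [] ≡ a ∷ v → Conjugate u v
  conj-letter a [] v e with ∷-injective e
  ... | refl , refl = conj-refl []
  conj-letter a (b ∷ u) v e with ∷-injective e
  ... | refl , u·a≡v = b ∷ [] , u , refl , sym u·a≡v

  reverse-apply : (f : Subst k) (w : Word k) →
                  reverse (apply f w) ≡ apply (reverse ∘ f) (reverse w)
  reverse-apply f [] = refl
  reverse-apply f (x ∷ w) = begin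
      reverse (f x ++ apply f w)
    ≡⟨ reverse-++ (f x) (apply f w) ⟩
      reverse (apply f w) ++ reverse (f x)
    ≡⟨ cong₂ _++_ (reverse-apply f w) (sym (++-identityʳ (reverse (f x)))) ⟩
      apply f̃ (reverse w) ++ apply f̃ (x ∷ [])
    ≡⟨ sym (concatMap-++ f̃ (reverse w) (x ∷ [])) ⟩
      apply f̃ (reverse w ++ x ∷ [])
    ≡⟨ cong (apply f̃) (sym (unfold-reverse x w)) ⟩
      apply f̃ (reverse (x ∷ w))
    ∎
    where
      open ≡-Reasoning
      f̃ : Subst k
      f̃ = reverse ∘ f

  mirror : Generator k → Generator k
  mirror (gψ a)    = gψbar a
  mirror (gψbar a) = gψ a
  mirror (gθ a b)  = gθ a b

  reverse-letter-image : (g : Generator k) → reverse ∘ ⟦ g ⟧g ≗ ⟦ mirror g ⟧g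
  reverse-letter-image (gψ a) x with x ≟ a
  ... | yes _ = refl
  ... | no  _ = refl
  reverse-letter-image (gψbar a) x with x ≟ a
  ... | yes _ = refl
  ... | no  _ = refl
  reverse-letter-image (gθ a b) x with x ≟ a
  ... | yes _ = refl
  ... | no  _ with x ≟ b
  ...   | yes _ = refl
  ...   | no  _ = refl

  reverse-apply-mirror : (g : Generator k) (w : Word k) →
    reverse (apply ⟦ g ⟧g w) ≡ apply ⟦ mirror g ⟧g (reverse w)
  reverse-apply-mirror g w =
    trans (reverse-apply ⟦ g ⟧g w)
          (concatMap-cong (reverse-letter-image g) (reverse w))

  ψ-shift-letter : (a x : Fin k) → ψ a x ++ a ∷ [] ≡ a ∷ ψbar a x
  ψ-shift-letter a x with x ≟ a
  ... | yes _ = refl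
  ... | no  _ = refl

  ψ-shift : (a : Fin k) (w : Word k) →
            apply (ψ a) w ++ a ∷ [] ≡ a ∷ apply (ψbar a) w
  ψ-shift a [] = refl
  ψ-shift a (x ∷ w) = begin
      (ψ a x ++ apply (ψ a) w) ++ a ∷ []
    ≡⟨ ++-assoc (ψ a x) (apply (ψ a) w) (a ∷ []) ⟩
      ψ a x ++ (apply (ψ a) w ++ a ∷ [])
    ≡⟨ cong (ψ a x ++_) (ψ-shift a w) ⟩
      ψ a x ++ a ∷ apply (ψbar a) w
    ≡⟨ sym (++-assoc (ψ a x) (a ∷ []) (apply (ψbar a) w)) ⟩
      (ψ a x ++ a ∷ []) ++ apply (ψbar a) w
    ≡⟨ cong (_++ apply (ψbar a) w) (ψ-shift-letter a x) ⟩
      a ∷ (ψbar a x ++ apply (ψbar a) w)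
    ∎
    where open ≡-Reasoning

  conj-mirror : (g : Generator k) (w : Word k) →
                Conjugate (apply ⟦ g ⟧g w) (apply ⟦ mirror g ⟧g w)
  conj-mirror (gψ a)    w = conj-letter a _ _ (ψ-shift a w)
  conj-mirror (gψbar a) w = conj-sym (conj-letter a _ _ (ψ-shift a w))
  conj-mirror (gθ a b)  w = conj-refl _

  -- Elementary morphisms preserve the property of being conjugate to
  -- one's reversal: g w ~ g* w ~ g*(w̃) = (g w)~.
  conj-reverse-step : (g : Generator k) (w : Word k) → Conjugate w (reverse w) →
    Conjugate (apply ⟦ g ⟧g w) (reverse (apply ⟦ g ⟧g w))
  conj-reverse-step g w w~w̃ =
    subst (Conjugate (apply ⟦ g ⟧g w)) (sym (reverse-apply-mirror g w))
      (conj-trans (conj-mirror g w) (conj-apply ⟦ mirror g ⟧g w~w̃))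

  epichristoffel-conj-reverse : {w : Word k} → IsCEpichristoffel w →
                                Conjugate w (reverse w)
  epichristoffel-conj-reverse (gs , a , refl) = go gs
    where
      go : (gs : List (Generator k)) →
           Conjugate (applyEpi gs (a ∷ [])) (reverse (applyEpi gs (a ∷ [])))
      go []       = conj-refl (a ∷ [])
      go (g ∷ gs) = conj-reverse-step g _ (go gs)

  factor-reverse : {u v : Word k} → Factor u v → Factor (reverse u) (reverse v)
  factor-reverse {u} (p , s , refl) = reverse s , reverse p , (begin
      reverse (p ++ u ++ s)
    ≡⟨ reverse-++ p (u ++ s) ⟩
      reverse (u ++ s) ++ reverse p
    ≡⟨ cong (_++ reverse p) (reverse-++ u s) ⟩
      (reverse s ++ reverse u) ++ reverse p
    ≡⟨ ++-assoc (reverse s) (reverse u) (reverse p) ⟩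
      reverse s ++ reverse u ++ reverse p
    ∎)
    where open ≡-Reasoning

  conj-factors-reverse-closed : {w : Word k} → Conjugate w (reverse w) →
    (u : Word k) → InConjFactors w u → InConjFactors w (reverse u)
  conj-factors-reverse-closed w~w̃ u (|u|≤|w| , v , w~v , u∈v) =
    subst (_≤ _) (sym (length-reverse u)) |u|≤|w| ,
    reverse v ,
    conj-trans w~w̃ (conj-reverse w~v) ,
    factor-reverse u∈v

proposition4p12 : ∀ (k : ℕ) (w : Word k) → IsCEpichristoffel w →
    ∀ (u : Word k) → InConjFactors w u → InConjFactors w (reverse u)
proposition4p12 k w epi =
  conj-factors-reverse-closed (epichristoffel-conj-reverse epi)
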